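{- Let $X$ be a connected, finite, simple $3$-valent graph equipped with an orientation at each vertex, and let $k\in\mathbb{N}$, $k\ge1$. Then: (1) $4$ is an eigenvalue of the Laplacian of $\mathrm{GC}_{2k,0}(X)$ with multiplicity at least $\lceil k/2\rceil$; (2) $2$ is an eigenvalue of the Laplacian of $\mathrm{GC}_{2k,0}(X)$ with multiplicity at least $\lfloor k/2\rfloor$.
   Context: Graphs are finite, simple, connected. An orientation at each vertex of $X$ is a choice, for every vertex $p$, of a cyclic ordering of the edges incident to $p$. The Laplacian of a graph $Y$ acts on $f:V(Y)\to\mathbb{C}$ by $(\Delta_Y f)(p)=\deg(p)f(p)-\sum_{q\sim p}f(q)$. Goldberg–Coxeter construction (3-valent case): let $\omega=e^{\pi i/3}$ and $\mathbb{Z}[\omega]$ the triangular lattice in $\mathbb{C}$ (small triangles: translates of the triangles with vertices $0,1,\omega$ and $1,1+\omega,\omega$). For $(k,l)\ne(0,0)$ put $z=k+l\omega$ and let $T$ be the closed triangle with vertices $0,z,\omega z$. Let $\overline{T}$ be the graph whose vertices are the barycenters of the small triangles meeting the interior of $T$, adjacent when the small triangles share an edge. For each vertex $p$ of $X$ take a copy $\overline{T}(p)$, matching the edges at $p$ with the sides of $T$ so that the cyclic order at $p$ agrees with the counterclockwise order of the sides. For each edge $e=\{p,q\}$ place $\overline{T}(p)$ on $T$ with $e$ corresponding to the side $[z,\omega z]$, place $\overline{T}(q)$ orientation-preservingly on the image of $T$ under rotation by $\pi$ about the midpoint of that side with $e$ corresponding to the same side, and identify coinciding vertices and edges. The resulting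 $3$-valent graph is $\mathrm{GC}_{k,l}(X)$. -}

module Defs where

open import Data.Nat as ℕ using (ℕ; zero; suc; _+_; _∸_; _≤_; _<_; _≤?_; s≤s; z≤n)
open import Data.Nat.Properties using (+-suc; +-identityʳ; m∸n+n≡m; ≤-trans; n≤1+n; m∸n≤m; ≤-pred)
open import Data.Fin using (Fin; _≟_)
open import Data.Fin.Patterns using (0F; 1F; 2F)
open import Data.Integer using (ℤ; +_; _-_; _*_) renaming (_+_ to _+ℤ_)
open import Data.Product using (Σ; ∃-syntax; _×_; _,_)
open import Function.Definitions using (Injective)
open import Relation.Binary.PropositionalEquality using (_≡_; _≢_; subst; sym)
open import Relation.Nullary using (yes; no)

-- Vertex set Fin n; nb p : Fin 3 → Fin n lists the three neighbours of p
-- (= the three edges at p, the graph being simple) in the cyclic order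
-- chosen at p: nb p 0 → nb p 1 → nb p 2 → nb p 0.
-- p and q are adjacent iff q ≡ nb p i for some i.

data Reach {n : ℕ} (nb : Fin n → Fin 3 → Fin n) (p : Fin n) : Fin n → Set where
  here : Reach nb p p
  step : ∀ {q} (i : Fin 3) → Reach nb p q → Reach nb p (nb q i)

record OrientedCubicGraph (n : ℕ) : Set where
  field
    nb        : Fin n → Fin 3 → Fin n
    nb-inj    : ∀ p → Injective _≡_ _≡_ (nb p)
    loopless  : ∀ p i → nb p i ≢ p
    symmetric : ∀ p i → ∃[ j ] nb (nb p i) j ≡ p
    -- connected (and nonempty)
    base      : Fin n
    connected : ∀ p q → Reach nb p q

back : ∀ {n} → (Fin 3 → Fin n) → Fin n → Fin 3
back g p with g 0F ≟ p | g 1F ≟ p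
... | yes _ | _     = 0F
... | no _  | yes _ = 1F
... | no _  | no _  = 2F

-- The triangle T with vertices 0, m, mω (z = m + 0ω), cut into m² small
-- triangles.  A lattice point a + bω is written (a , b).
--   up a b   : triangle with vertices (a,b), (a+1,b), (a,b+1)      (a+b+1 ≤ m)
--   down a b : triangle with vertices (a+1,b), (a+1,b+1), (a,b+1)  (a+b+2 ≤ m)
-- These are exactly the small triangles meeting the interior of T, i.e.
-- the vertices of T̄.

data Tri (m : ℕ) : Set where
  up   : (a b : ℕ) → a + b < m → Tri m
  down : (a b : ℕ) → suc (suc (a + b)) ≤ m → Tri m

-- Sides of T in counterclockwise order: side 0 = [0,z], side 1 = [z,ωz],
-- side 2 = [ωz,0].  The boundary small triangles along side i, indexed
-- by their position t = 0 … m-1 going counterclockwise along the side.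

private
  lem1 : ∀ m t → t < m → (m ∸ suc t) + t < m
  lem1 m t t<m = subst (λ x → x ≤ m) (+-suc (m ∸ suc t) t)
                       (subst (λ x → (m ∸ suc t) + suc t ≤ x) (m∸n+n≡m t<m) Data.Nat.Properties.≤-refl)
  lem0 : ∀ m t → t < m → m ∸ suc t < m
  lem0 (suc m) t _ = s≤s (m∸n≤m m t)
  lem2 : ∀ a b m → a + suc b < m → suc (suc (a + b)) ≤ m
  lem2 a b m h = subst (λ x → suc x ≤ m) (+-suc a b) h
  lem3 : ∀ a b m → suc (suc (a + b)) ≤ m → a + suc b < m
  lem3 a b m h = subst (λ x → suc x ≤ m) (sym (+-suc a b)) h
  lem4 : ∀ a m → a + 0 < m → a < m
  lem4 a m h = subst (λ x → suc x ≤ m) (+-identityʳ a) h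
  lem5 : ∀ t m → t < m → t + 0 < m
  lem5 t m h = subst (λ x → suc x ≤ m) (sym (+-identityʳ t)) h
  lem6 : ∀ a b m → suc (suc (a + b)) ≤ m → a + b < m
  lem6 a b m h = ≤-trans (n≤1+n _) h

bdry : (m : ℕ) → Fin 3 → (t : ℕ) → t < m → Tri m
bdry m 0F t h = up t 0 (lem5 t m h)
bdry m 1F t h = up (m ∸ suc t) t (lem1 m t h)
bdry m 2F t h = up 0 (m ∸ suc t) (lem0 m t h)

-- Goldberg–Coxeter GC_{m,0}(X): vertex set Fin n × Tri m (a copy T̄(p)
-- for each p).  Edge nb p i of X corresponds to side i of T(p).  Gluing
-- T(q) to T(p) along e = {p,q} (rotation by π about the midpoint of the
-- common side) matches the boundary triangle at position t on the side of
-- e in T(p) with the one at position m-1-t on the side of e in T(q).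

module GC {n : ℕ} (X : OrientedCubicGraph n) (m : ℕ) where
  open OrientedCubicGraph X

  Vtx : Set
  Vtx = Fin n × Tri m

  cross : Fin n → Fin 3 → (t : ℕ) → t < m → Vtx
  cross p i t h = q , bdry m (back (nb q) p) (m ∸ suc t) (lem0 m t h)
    where q = nb p i

  nbr : Vtx → Fin 3 → Vtx
  -- up a b : across [(a,b),(a+1,b)], [(a+1,b),(a,b+1)], [(a,b),(a,b+1)]
  nbr (p , up a zero h)    0F = cross p 0F a (lem4 a m h)
  nbr (p , up a (suc b) h) 0F = p , down a b (lem2 a b m h)
  nbr (p , up a b h)       1F with suc (suc (a + b)) ≤? m
  ... | yes h' = p , down a b h'
  ... | no _   = cross p 1F (m ∸ suc a) (lem0 m a (≤-trans (s≤s (Data.Nat.Properties.m≤m+n a b)) h))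
  nbr (p , up zero b h)    2F = cross p 2F (m ∸ suc b) (lem0 m b h)
  nbr (p , up (suc a) b h) 2F = p , down a b h
  nbr (p , down a b h) 0F = p , up a b (lem6 a b m h)
  nbr (p , down a b h) 1F = p , up (suc a) b h
  nbr (p , down a b h) 2F = p , up a (suc b) (lem3 a b m h)

Laplacian3 : {V : Set} → (V → Fin 3 → V) → (V → ℤ) → V → ℤ
Laplacian3 nbr f v = (+ 3) * f v - (f (nbr v 0F) +ℤ (f (nbr v 1F) +ℤ f (nbr v 2F)))

sumFin : (r : ℕ) → (Fin r → ℤ) → ℤ
sumFin zero    c = + 0
sumFin (suc r) c = c Fin.zero +ℤ sumFin r (λ j → c (Fin.suc j))
  where import Data.Fin as Fin

-- f₀ … f_{r-1} are linearly independent (over ℤ, equivalently over ℚ).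
LinIndep : {V : Set} {r : ℕ} → (Fin r → V → ℤ) → Set
LinIndep {V} {r} f = (c : Fin r → ℤ) → (∀ v → sumFin r (λ j → c j * f j v) ≡ + 0) → ∀ j → c j ≡ + 0

EigenvalueMultAtLeast : {V : Set} → (V → Fin 3 → V) → ℤ → ℕ → Set
EigenvalueMultAtLeast {V} nbr λ' r =
  Σ (Fin r → V → ℤ) λ f →
    (∀ j v → Laplacian3 nbr (f j) v ≡ λ' * f j v) × LinIndep f

-- Give a small triangle of T the coordinates (a, b, c), its distances (in rows
-- of small triangles) to the three sides of T, so a + b + c = m - 1 for an
-- upward and m - 2 for a downward triangle, m = 2k.  For χ : ℕ → ℤ with
-- χ 0 = 0 and χ (m - h) = τ χ h, τ = ±1, put φ x y = (-1)^x χ y and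
--   up (a, b, c)   ↦  φ a b + φ b c + φ c a,
--   down (a, b, c) ↦  -τ (φ a (b+1) + φ b (c+1) + φ c (a+1)).
-- The sign (-1)^x makes the three neighbours of a triangle telescope to the
-- value of the triangle times -τ (up to the factor τ² = 1), which is the
-- eigenvalue equation Δ f = (3 + τ) f.  The same function is used on every
-- copy T(p); it is cyclically symmetric in (a, b, c), so gluing along any side
-- in any orientation is compatible, and the two conditions on χ are exactly
-- what is needed across the sides of T.  Taking χ = point mass at an odd d,
-- symmetrised under h ↦ m - h, gives eigenfunctions that are independent by
-- evaluation at the triangles up(0, d): ⌈k/2⌉ of them for τ = 1 (eigenvalue 4)
-- and ⌊k/2⌋ for τ = -1 (eigenvalue 2), where the count is limited by the
-- requirement that d ≠ m - d' for distinct d, d' and, when τ = -1, d ≠ m - d.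

module Submission where

open import Defs
open import Data.Nat using (ℕ; _*_; _≤_; ⌈_/2⌉; ⌊_/2⌋)
open import Data.Integer using (+_)
open import Data.Product using (_×_)

open import Data.Nat using (zero; suc; _+_; _∸_; _<_; _≟_; _≤?_; s≤s)
import Data.Nat.Properties as ℕ
open import Data.Integer using (ℤ; -_; 0ℤ; 1ℤ; -1ℤ; _^_)
  renaming (_+_ to _+ℤ_; _*_ to _*ℤ_; _-_ to _-ℤ_)
import Data.Integer.Properties as ℤ
open import Data.Integer.Tactic.RingSolver using (solve-∀)
open import Data.Fin as Fin using (Fin; toℕ)
open import Data.Fin.Properties using (toℕ-injective; toℕ<n; suc-injective)
open import Data.Fin.Patterns using (0F; 1F; 2F)
open import Data.Product using (_,_; proj₁; proj₂)
open import Data.Empty using (⊥-elim)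
open import Data.Sum using (inj₁; inj₂)
open import Function using (_∘_)
open import Relation.Binary.Definitions using (tri<; tri≈; tri>)
open import Relation.Binary.PropositionalEquality
open import Relation.Nullary using (Dec; yes; no; ¬_; contradiction)

open ≡-Reasoning

suc[m∸[1+n]]≡m∸n : ∀ {m n} → n < m → suc (m ∸ suc n) ≡ m ∸ n
suc[m∸[1+n]]≡m∸n n<m = sym (ℕ.+-∸-assoc 1 n<m)

m∸[1+[m∸[1+n]]]≡n : ∀ {m n} → n < m → m ∸ suc (m ∸ suc n) ≡ n
m∸[1+[m∸[1+n]]]≡n {m} n<m =
  trans (cong (m ∸_) (suc[m∸[1+n]]≡m∸n n<m)) (ℕ.m∸[m∸n]≡n (ℕ.<⇒≤ n<m))

odd+odd≡2*suc : ∀ i j → suc (2 * i) + suc (2 * j) ≡ 2 * suc (i + j)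
odd+odd≡2*suc i j = begin
  suc (2 * i + suc (2 * j))  ≡⟨ cong suc (ℕ.+-suc (2 * i) (2 * j)) ⟩
  2 + (2 * i + 2 * j)        ≡⟨ cong (suc ∘ suc) (ℕ.*-distribˡ-+ 2 i j) ⟨
  2 + 2 * (i + j)            ≡⟨ ℕ.*-suc 2 (i + j) ⟨
  2 * suc (i + j)            ∎

⌊n/2⌋+⌊n/2⌋≤n : ∀ n → ⌊ n /2⌋ + ⌊ n /2⌋ ≤ n
⌊n/2⌋+⌊n/2⌋≤n n =
  subst (⌊ n /2⌋ + ⌊ n /2⌋ ≤_) (ℕ.⌊n/2⌋+⌈n/2⌉≡n n)
        (ℕ.+-monoʳ-≤ ⌊ n /2⌋ (ℕ.⌊n/2⌋≤⌈n/2⌉ n))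

1+i+j<r+r : ∀ {r} (i j : Fin r) → suc (toℕ i + toℕ j) < r + r
1+i+j<r+r {r} i j =
  subst (_≤ r + r) (cong suc (ℕ.+-suc (toℕ i) (toℕ j))) (ℕ.+-mono-≤ (toℕ<n i) (toℕ<n j))

2+i+j<r+r-ordered : ∀ {r} (i j : Fin r) → toℕ i < toℕ j → 2 + (toℕ i + toℕ j) < r + r
2+i+j<r+r-ordered {r} i j i<j =
  subst (_≤ r + r) (cong (suc ∘ suc) (ℕ.+-suc (toℕ i) (toℕ j)))
        (ℕ.+-mono-≤ (ℕ.≤-trans (s≤s i<j) (toℕ<n j)) (toℕ<n j))

2+i+j<r+r : ∀ {r} (i j : Fin r) → i ≢ j → 2 + (toℕ i + toℕ j) < r + r
2+i+j<r+r {r} i j i≢j with ℕ.<-cmp (toℕ i) (toℕ j)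
... | tri< i<j _ _ = 2+i+j<r+r-ordered i j i<j
... | tri≈ _ i≡j _ = ⊥-elim (i≢j (toℕ-injective i≡j))
... | tri> _ _ j<i =
  subst (λ s → 2 + s < r + r) (ℕ.+-comm (toℕ j) (toℕ i)) (2+i+j<r+r-ordered j i j<i)

⌈k/2⌉-antipodal⇒≡ : ∀ k (i j : Fin ⌈ k /2⌉) → suc (toℕ i + toℕ j) ≡ k → i ≡ j
⌈k/2⌉-antipodal⇒≡ k i j e with i Fin.≟ j
... | yes i≡j = i≡j
... | no i≢j = contradiction (subst (suc (toℕ i + toℕ j) <_) (sym e) sum<k) (ℕ.<-irrefl refl)
  where
  sum<k : suc (toℕ i + toℕ j) < k
  sum<k = ℕ.≤-pred (ℕ.≤-trans (2+i+j<r+r i j i≢j) (⌊n/2⌋+⌊n/2⌋≤n (suc k)))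

⌊k/2⌋-antipodal-free : ∀ k (i j : Fin ⌊ k /2⌋) → suc (toℕ i + toℕ j) ≢ k
⌊k/2⌋-antipodal-free k i j e =
  ℕ.<-irrefl e (ℕ.≤-trans (1+i+j<r+r i j) (⌊n/2⌋+⌊n/2⌋≤n k))

-1^n*-1^n≡1 : ∀ n → -1ℤ ^ n *ℤ -1ℤ ^ n ≡ 1ℤ
-1^n*-1^n≡1 zero    = refl
-1^n*-1^n≡1 (suc n) = trans (square-neg (-1ℤ ^ n)) (-1^n*-1^n≡1 n)
  where
  square-neg : ∀ x → (-1ℤ *ℤ x) *ℤ (-1ℤ *ℤ x) ≡ x *ℤ x
  square-neg = solve-∀

-1^[2*k]≡1 : ∀ k → -1ℤ ^ (2 * k) ≡ 1ℤ
-1^[2*k]≡1 k = trans (sym (ℤ.^-*-assoc -1ℤ 2 k)) (ℤ.^-zeroˡ k)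

-1^[m∸[1+t]]≡-[-1^t] : ∀ {m t} → -1ℤ ^ m ≡ 1ℤ → t < m → -1ℤ ^ (m ∸ suc t) ≡ - (-1ℤ ^ t)
-1^[m∸[1+t]]≡-[-1^t] {m} {t} -1^m≡1 t<m = begin
  s                  ≡⟨ ℤ.*-identityʳ s ⟨
  s *ℤ 1ℤ            ≡⟨ cong (s *ℤ_) (-1^n*-1^n≡1 (suc t)) ⟨
  s *ℤ (u *ℤ u)      ≡⟨ ℤ.*-assoc s u u ⟨
  (s *ℤ u) *ℤ u      ≡⟨ cong (_*ℤ u) s*u≡1 ⟩
  1ℤ *ℤ u            ≡⟨ ℤ.*-identityˡ u ⟩
  -1ℤ *ℤ -1ℤ ^ t     ≡⟨ ℤ.-1*i≡-i (-1ℤ ^ t) ⟩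
  - (-1ℤ ^ t)        ∎
  where
  s = -1ℤ ^ (m ∸ suc t)
  u = -1ℤ ^ suc t
  s*u≡1 : s *ℤ u ≡ 1ℤ
  s*u≡1 = trans (sym (ℤ.^-distribˡ-+-* -1ℤ (m ∸ suc t) (suc t)))
                (trans (cong (-1ℤ ^_) (ℕ.m∸n+n≡m t<m)) -1^m≡1)

i*i≡1⇒i*i*j≡j : ∀ {i} → i *ℤ i ≡ 1ℤ → ∀ j → i *ℤ i *ℤ j ≡ j
i*i≡1⇒i*i*j≡j i*i≡1 j = trans (cong (_*ℤ j) i*i≡1) (ℤ.*-identityˡ j)

δ : ℕ → ℕ → ℤ
δ x y with x ≟ y
... | yes _ = 1ℤ
... | no _  = 0ℤ

δ-≡ : ∀ {x y} → x ≡ y → δ x y ≡ 1ℤ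
δ-≡ {x} {y} x≡y with x ≟ y
... | yes _  = refl
... | no x≢y = contradiction x≡y x≢y

δ-≢ : ∀ {x y} → x ≢ y → δ x y ≡ 0ℤ
δ-≢ {x} {y} x≢y with x ≟ y
... | yes x≡y = contradiction x≡y x≢y
... | no _    = refl

δ-cong : ∀ {x y u v} → (x ≡ y → u ≡ v) → (u ≡ v → x ≡ y) → δ x y ≡ δ u v
δ-cong {x} {y} {u} {v} to from with x ≟ y | u ≟ v
... | yes _   | yes _   = refl
... | yes x≡y | no u≢v  = contradiction (to x≡y) u≢v
... | no x≢y  | yes u≡v = contradiction (from u≡v) x≢y
... | no _    | no _    = refl

sumFin-zero : ∀ r (t : Fin r → ℤ) → (∀ j → t j ≡ 0ℤ) → sumFin r t ≡ 0ℤ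
sumFin-zero zero    t t≡0 = refl
sumFin-zero (suc r) t t≡0 =
  cong₂ _+ℤ_ (t≡0 Fin.zero) (sumFin-zero r (t ∘ Fin.suc) (t≡0 ∘ Fin.suc))

sumFin-single : ∀ r (t : Fin r → ℤ) i → (∀ j → j ≢ i → t j ≡ 0ℤ) → sumFin r t ≡ t i
sumFin-single (suc r) t Fin.zero t≡0 = begin
  t Fin.zero +ℤ sumFin r (λ j → t (Fin.suc j))
    ≡⟨ cong (t Fin.zero +ℤ_) (sumFin-zero r _ (λ j → t≡0 (Fin.suc j) (λ ()))) ⟩
  t Fin.zero +ℤ 0ℤ
    ≡⟨ ℤ.+-identityʳ (t Fin.zero) ⟩
  t Fin.zero ∎
sumFin-single (suc r) t (Fin.suc i) t≡0 = begin
  t Fin.zero +ℤ sumFin r (λ j → t (Fin.suc j))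
    ≡⟨ cong₂ _+ℤ_ (t≡0 Fin.zero (λ ()))
                  (sumFin-single r _ i (λ j j≢i → t≡0 (Fin.suc j) (j≢i ∘ suc-injective))) ⟩
  0ℤ +ℤ t (Fin.suc i)
    ≡⟨ ℤ.+-identityˡ (t (Fin.suc i)) ⟩
  t (Fin.suc i) ∎

diagonal⇒LinIndep : ∀ {V : Set} {r} (f : Fin r → V → ℤ) (v : Fin r → V) →
                    (∀ i j → i ≢ j → f j (v i) ≡ 0ℤ) → (∀ i → f i (v i) ≢ 0ℤ) → LinIndep f
diagonal⇒LinIndep {r = r} f v off-diagonal diagonal c Σcf≡0 i
  with ℤ.i*j≡0⇒i≡0∨j≡0 (c i) ci*fi≡0
  where
  ci*fi≡0 : c i *ℤ f i (v i) ≡ 0ℤ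
  ci*fi≡0 = trans (sym (sumFin-single r _ i other-terms-vanish)) (Σcf≡0 (v i))
    where
    other-terms-vanish : ∀ j → j ≢ i → c j *ℤ f j (v i) ≡ 0ℤ
    other-terms-vanish j j≢i =
      trans (cong (c j *ℤ_) (off-diagonal i j (j≢i ∘ sym))) (ℤ.*-zeroʳ (c j))
... | inj₁ ci≡0 = ci≡0
... | inj₂ fi≡0 = contradiction fi≡0 (diagonal i)

-- The eigenfunction attached to φ

module Eigenfunction
  (m : ℕ) (τ : ℤ) (φ : ℕ → ℕ → ℤ)
  (τ-involutive : τ *ℤ τ ≡ 1ℤ)
  (φ-suc : ∀ x y → φ (suc x) y ≡ - φ x y)
  (φ-zeroʳ : ∀ x → φ x 0 ≡ 0ℤ)
  (φ-reflectˡ : ∀ t y → t < m → φ (m ∸ suc t) y ≡ - φ t y)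
  (φ-reflectʳ : ∀ x h → h ≤ m → φ x (m ∸ h) ≡ τ *ℤ φ x h)
  where

  upValue downValue belowValue : ℕ → ℕ → ℕ → ℤ
  upValue    a b c = φ a b +ℤ (φ b c +ℤ φ c a)
  downValue  a b c = (- τ) *ℤ (φ a (suc b) +ℤ (φ b (suc c) +ℤ φ c (suc a)))
  -- downValue a (b - 1) c, rewritten with φ (b - 1) = - φ b so that it makes
  -- sense for b = 0: the value required across the side b = 0 of T.
  belowValue a b c = (- τ) *ℤ (φ a b +ℤ (- φ b (suc c) +ℤ φ c (suc a)))

  triValue : Tri m → ℤ
  triValue (up a b _)   = upValue a b (m ∸ suc (a + b))
  triValue (down a b _) = downValue a b (m ∸ suc (suc (a + b)))

  private
    rotate : ∀ x y z → x +ℤ (y +ℤ z) ≡ y +ℤ (z +ℤ x)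
    rotate = solve-∀

    τ*τ*x≡x : ∀ x → τ *ℤ τ *ℤ x ≡ x
    τ*τ*x≡x = i*i≡1⇒i*i*j≡j {τ} τ-involutive

  upValue-rotate : ∀ a b c → upValue a b c ≡ upValue b c a
  upValue-rotate a b c = rotate (φ a b) (φ b c) (φ c a)

  downValue-rotate : ∀ a b c → downValue a b c ≡ downValue b c a
  downValue-rotate a b c = cong ((- τ) *ℤ_) (rotate (φ a (suc b)) (φ b (suc c)) (φ c (suc a)))

  belowValue-suc : ∀ a b c → belowValue a (suc b) c ≡ downValue a b c
  belowValue-suc a b c =
    cong (λ w → (- τ) *ℤ (φ a (suc b) +ℤ (w +ℤ φ c (suc a))))
         (trans (cong -_ (φ-suc b (suc c))) (ℤ.neg-involutive (φ b (suc c))))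

  triValue-bdry : ∀ i t (t<m : t < m) → triValue (bdry m i t t<m) ≡ upValue t 0 (m ∸ suc t)
  triValue-bdry 0F t t<m = cong (λ s → upValue t 0 (m ∸ suc s)) (ℕ.+-identityʳ t)
  triValue-bdry 1F t t<m = begin
    upValue t′ t (m ∸ suc (t′ + t)) ≡⟨ cong (upValue t′ t) c≡0 ⟩
    upValue t′ t 0                  ≡⟨ upValue-rotate t′ t 0 ⟩
    upValue t 0 t′                  ∎
    where
    t′ = m ∸ suc t
    c≡0 : m ∸ suc (t′ + t) ≡ 0
    c≡0 = trans (cong (λ s → m ∸ (s + t)) (suc[m∸[1+n]]≡m∸n t<m))
                (trans (cong (m ∸_) (ℕ.m∸n+n≡m (ℕ.<⇒≤ t<m))) (ℕ.n∸n≡0 m))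
  triValue-bdry 2F t t<m = begin
    upValue 0 t′ (m ∸ suc t′) ≡⟨ cong (upValue 0 t′) (m∸[1+[m∸[1+n]]]≡n t<m) ⟩
    upValue 0 t′ t            ≡⟨ upValue-rotate t 0 t′ ⟨
    upValue t 0 t′            ∎
    where t′ = m ∸ suc t

  -- The only place where the conditions on χ enter: an upward triangle on a
  -- side of T(q) seen from the adjacent copy T(p).
  boundary-crossing : ∀ t → t < m → upValue (m ∸ suc t) 0 t ≡ belowValue t 0 (m ∸ suc t)
  boundary-crossing t t<m = begin
    φ t′ 0 +ℤ (φ 0 t +ℤ φ t t′)
      ≡⟨ cong₂ _+ℤ_ (φ-zeroʳ t′) (cong (φ 0 t +ℤ_) (φ-reflectʳ t (suc t) t<m)) ⟩
    0ℤ +ℤ (x +ℤ τ *ℤ y)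
      ≡⟨ cong (λ w → 0ℤ +ℤ (w +ℤ τ *ℤ y)) (τ*τ*x≡x x) ⟨
    0ℤ +ℤ (τ *ℤ τ *ℤ x +ℤ τ *ℤ y)
      ≡⟨ expand τ x y ⟨
    (- τ) *ℤ (0ℤ +ℤ (- (τ *ℤ x) +ℤ - y))
      ≡⟨ cong (λ w → (- τ) *ℤ w) (cong₂ _+ℤ_ (φ-zeroʳ t) (cong₂ (λ u w → - u +ℤ w) φ0 φt)) ⟨
    (- τ) *ℤ (φ t 0 +ℤ (- φ 0 (suc t′) +ℤ φ t′ (suc t))) ∎
    where
    t′ = m ∸ suc t
    x = φ 0 t
    y = φ t (suc t)
    φ0 : φ 0 (suc t′) ≡ τ *ℤ x
    φ0 = trans (cong (φ 0) (suc[m∸[1+n]]≡m∸n t<m)) (φ-reflectʳ 0 t (ℕ.<⇒≤ t<m))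
    φt : φ t′ (suc t) ≡ - y
    φt = φ-reflectˡ t (suc t) t<m
    expand : ∀ τ x y → (- τ) *ℤ (0ℤ +ℤ (- (τ *ℤ x) +ℤ - y)) ≡ 0ℤ +ℤ (τ *ℤ τ *ℤ x +ℤ τ *ℤ y)
    expand = solve-∀

  upValue-eigen : ∀ a b c →
    + 3 *ℤ upValue a b c -ℤ (belowValue a b c +ℤ (belowValue b c a +ℤ belowValue c a b))
      ≡ (+ 3 +ℤ τ) *ℤ upValue a b c
  upValue-eigen a b c =
    identity τ (φ a b) (φ b c) (φ c a) (φ a (suc b)) (φ b (suc c)) (φ c (suc a))
    where
    identity : ∀ τ x y z x′ y′ z′ →
      + 3 *ℤ (x +ℤ (y +ℤ z)) -ℤ
        ((- τ) *ℤ (x +ℤ (- y′ +ℤ z′)) +ℤ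
          ((- τ) *ℤ (y +ℤ (- z′ +ℤ x′)) +ℤ (- τ) *ℤ (z +ℤ (- x′ +ℤ y′))))
        ≡ (+ 3 +ℤ τ) *ℤ (x +ℤ (y +ℤ z))
    identity = solve-∀

  downValue-eigen : ∀ a b c →
    + 3 *ℤ downValue a b c -ℤ (upValue a b (suc c) +ℤ (upValue (suc a) b c +ℤ upValue a (suc b) c))
      ≡ (+ 3 +ℤ τ) *ℤ downValue a b c
  downValue-eigen a b c rewrite φ-suc c a | φ-suc a b | φ-suc b c = begin
    + 3 *ℤ ((- τ) *ℤ S) -ℤ neighbours  ≡⟨ cong (+ 3 *ℤ ((- τ) *ℤ S) -ℤ_) (telescope x y z x′ y′ z′) ⟩
    + 3 *ℤ ((- τ) *ℤ S) -ℤ S           ≡⟨ cong (+ 3 *ℤ ((- τ) *ℤ S) -ℤ_) (τ*τ*x≡x S) ⟨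
    + 3 *ℤ ((- τ) *ℤ S) -ℤ τ *ℤ τ *ℤ S ≡⟨ expand τ S ⟩
    (+ 3 +ℤ τ) *ℤ ((- τ) *ℤ S)         ∎
    where
    x = φ a b
    y = φ b c
    z = φ c a
    x′ = φ a (suc b)
    y′ = φ b (suc c)
    z′ = φ c (suc a)
    S = x′ +ℤ (y′ +ℤ z′)
    neighbours = (x +ℤ (y′ +ℤ - z)) +ℤ ((- x +ℤ (y +ℤ z′)) +ℤ (x′ +ℤ (- y +ℤ z)))
    telescope : ∀ x y z x′ y′ z′ →
      (x +ℤ (y′ +ℤ - z)) +ℤ ((- x +ℤ (y +ℤ z′)) +ℤ (x′ +ℤ (- y +ℤ z))) ≡ x′ +ℤ (y′ +ℤ z′)
    telescope = solve-∀
    expand : ∀ τ S → + 3 *ℤ ((- τ) *ℤ S) -ℤ τ *ℤ τ *ℤ S ≡ (+ 3 +ℤ τ) *ℤ ((- τ) *ℤ S)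
    expand = solve-∀

  triValue-up₀ : ∀ b (h : b < m) → triValue (up 0 b h) ≡ φ 0 b +ℤ φ b (m ∸ suc b)
  triValue-up₀ b h =
    trans (cong (λ w → φ 0 b +ℤ (φ b (m ∸ suc b) +ℤ w)) (φ-zeroʳ (m ∸ suc b)))
          (cong (φ 0 b +ℤ_) (ℤ.+-identityʳ _))

  module OnGoldbergCoxeter {n : ℕ} (X : OrientedCubicGraph n) where
    open GC X m
    open OrientedCubicGraph X using (nb)

    eigenfunction : Vtx → ℤ
    eigenfunction (_ , t) = triValue t

    cross-value : ∀ p i t (t<m : t < m) → eigenfunction (cross p i t t<m) ≡ belowValue t 0 (m ∸ suc t)
    cross-value p i t t<m = begin
      eigenfunction (cross p i t t<m)             ≡⟨ triValue-bdry (back (nb (nb p i)) p) (m ∸ suc t) _ ⟩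
      upValue (m ∸ suc t) 0 (m ∸ suc (m ∸ suc t)) ≡⟨ cong (upValue _ 0) (m∸[1+[m∸[1+n]]]≡n t<m) ⟩
      upValue (m ∸ suc t) 0 t                     ≡⟨ boundary-crossing t t<m ⟩
      belowValue t 0 (m ∸ suc t)                  ∎

    bottom-neighbour : ∀ p a b h →
      eigenfunction (nbr (p , up a b h) 0F) ≡ belowValue a b (m ∸ suc (a + b))
    bottom-neighbour p a zero h =
      trans (cross-value p 0F a _) (cong (λ s → belowValue a 0 (m ∸ suc s)) (sym (ℕ.+-identityʳ a)))
    bottom-neighbour p a (suc b) h =
      trans (sym (belowValue-suc a b _)) (cong (λ s → belowValue a (suc b) (m ∸ suc s)) (sym (ℕ.+-suc a b)))

    slant-interior : ∀ a b (h : suc (suc (a + b)) ≤ m) →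
      triValue (down a b h) ≡ belowValue b (m ∸ suc (a + b)) a
    slant-interior a b h = begin
      downValue a b c       ≡⟨ downValue-rotate a b c ⟩
      downValue b c a       ≡⟨ belowValue-suc b c a ⟨
      belowValue b (suc c) a ≡⟨ cong (λ w → belowValue b w a) (suc[m∸[1+n]]≡m∸n h) ⟩
      belowValue b (m ∸ suc (a + b)) a ∎
      where c = m ∸ suc (suc (a + b))

    slant-crossing : ∀ p a b (h : a + b < m) (t<m : m ∸ suc a < m) → ¬ (suc (suc (a + b)) ≤ m) →
      eigenfunction (cross p 1F (m ∸ suc a) t<m) ≡ belowValue b (m ∸ suc (a + b)) a
    slant-crossing p a b h t<m full = begin
      eigenfunction (cross p 1F (m ∸ suc a) t<m)      ≡⟨ cross-value p 1F (m ∸ suc a) t<m ⟩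
      belowValue (m ∸ suc a) 0 (m ∸ suc (m ∸ suc a))
        ≡⟨ cong₂ (λ u w → belowValue u 0 w) m∸[1+a]≡b m∸[1+[m∸[1+a]]]≡a ⟩
      belowValue b 0 a                                ≡⟨ cong (λ w → belowValue b w a) c≡0 ⟨
      belowValue b (m ∸ suc (a + b)) a                ∎
      where
      m∸[1+[m∸[1+a]]]≡a : m ∸ suc (m ∸ suc a) ≡ a
      m∸[1+[m∸[1+a]]]≡a = m∸[1+[m∸[1+n]]]≡n (ℕ.<-≤-trans (s≤s (ℕ.m≤m+n a b)) h)
      a+b+1≡m : suc (a + b) ≡ m
      a+b+1≡m = ℕ.≤-antisym h (ℕ.≮⇒≥ full)
      m∸[1+a]≡b : m ∸ suc a ≡ b
      m∸[1+a]≡b = trans (cong (_∸ suc a) (sym a+b+1≡m)) (ℕ.m+n∸m≡n a b)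
      c≡0 : m ∸ suc (a + b) ≡ 0
      c≡0 = trans (cong (m ∸_) a+b+1≡m) (ℕ.n∸n≡0 m)

    slant-neighbour : ∀ p a b h →
      eigenfunction (nbr (p , up a b h) 1F) ≡ belowValue b (m ∸ suc (a + b)) a
    slant-neighbour p a zero h with suc (suc (a + zero)) ≤? m
    ... | yes h′  = slant-interior a zero h′
    ... | no full = slant-crossing p a zero h _ full
    slant-neighbour p a (suc b) h with suc (suc (a + suc b)) ≤? m
    ... | yes h′  = slant-interior a (suc b) h′
    ... | no full = slant-crossing p a (suc b) h _ full

    left-crossing : ∀ p b (h : b < m) (t<m : m ∸ suc b < m) →
      eigenfunction (cross p 2F (m ∸ suc b) t<m) ≡ belowValue (m ∸ suc b) 0 b
    left-crossing p b h t<m =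
      trans (cross-value p 2F (m ∸ suc b) t<m) (cong (belowValue _ 0) (m∸[1+[m∸[1+n]]]≡n h))

    left-interior : ∀ a b (h : suc (suc (a + b)) ≤ m) →
      triValue (down a b h) ≡ belowValue (m ∸ suc (suc (a + b))) (suc a) b
    left-interior a b h = begin
      downValue a b c         ≡⟨ downValue-rotate c a b ⟨
      downValue c a b         ≡⟨ belowValue-suc c a b ⟨
      belowValue c (suc a) b  ∎
      where c = m ∸ suc (suc (a + b))

    left-neighbour : ∀ p a b h →
      eigenfunction (nbr (p , up a b h) 2F) ≡ belowValue (m ∸ suc (a + b)) a b
    left-neighbour p zero    zero    h = left-crossing p 0 h _
    left-neighbour p zero    (suc b) h = left-crossing p (suc b) h _
    left-neighbour p (suc a) zero    h = left-interior a 0 h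
    left-neighbour p (suc a) (suc b) h = left-interior a (suc b) h

    eigenfunction-isEigen : ∀ v → Laplacian3 nbr eigenfunction v ≡ (+ 3 +ℤ τ) *ℤ eigenfunction v
    eigenfunction-isEigen (p , up a b h) = begin
      + 3 *ℤ upValue a b c -ℤ (f (nbr v 0F) +ℤ (f (nbr v 1F) +ℤ f (nbr v 2F)))
        ≡⟨ cong (+ 3 *ℤ upValue a b c -ℤ_)
                (cong₂ _+ℤ_ (bottom-neighbour p a b h)
                            (cong₂ _+ℤ_ (slant-neighbour p a b h) (left-neighbour p a b h))) ⟩
      + 3 *ℤ upValue a b c -ℤ (belowValue a b c +ℤ (belowValue b c a +ℤ belowValue c a b))
        ≡⟨ upValue-eigen a b c ⟩
      (+ 3 +ℤ τ) *ℤ upValue a b c ∎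
      where
      f = eigenfunction
      v = (p , up a b h)
      c = m ∸ suc (a + b)
    eigenfunction-isEigen (p , down a b h) = begin
      + 3 *ℤ downValue a b c -ℤ
        (upValue a b (m ∸ suc (a + b)) +ℤ (upValue (suc a) b c +ℤ upValue a (suc b) (m ∸ suc (a + suc b))))
        ≡⟨ cong (+ 3 *ℤ downValue a b c -ℤ_)
                (cong₂ _+ℤ_ (cong (upValue a b) (sym (suc[m∸[1+n]]≡m∸n h)))
                            (cong (λ s → upValue (suc a) b c +ℤ upValue a (suc b) (m ∸ suc s)) (ℕ.+-suc a b))) ⟩
      + 3 *ℤ downValue a b c -ℤ (upValue a b (suc c) +ℤ (upValue (suc a) b c +ℤ upValue a (suc b) c))
        ≡⟨ downValue-eigen a b c ⟩
      (+ 3 +ℤ τ) *ℤ downValue a b c ∎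
      where c = m ∸ suc (suc (a + b))

-- Eigenfunctions from odd point masses

module OddPointMasses (k : ℕ) (τ : ℤ) (τ-involutive : τ *ℤ τ ≡ 1ℤ) where

  m : ℕ
  m = 2 * k

  private
    τ*τ*x≡x : ∀ x → τ *ℤ τ *ℤ x ≡ x
    τ*τ*x≡x = i*i≡1⇒i*i*j≡j {τ} τ-involutive

  χ : ℕ → ℕ → ℤ
  χ d y = δ y d +ℤ τ *ℤ δ (y + d) m

  χ-reflect : ∀ d h → h ≤ m → χ d (m ∸ h) ≡ τ *ℤ χ d h
  χ-reflect d h h≤m = begin
    δ (m ∸ h) d +ℤ τ *ℤ δ (m ∸ h + d) m ≡⟨ cong₂ (λ u w → u +ℤ τ *ℤ w) δ₁ δ₂ ⟩
    δ (h + d) m +ℤ τ *ℤ δ h d           ≡⟨ cong (_+ℤ τ *ℤ δ h d) (τ*τ*x≡x (δ (h + d) m)) ⟨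
    τ *ℤ τ *ℤ δ (h + d) m +ℤ τ *ℤ δ h d ≡⟨ factor τ (δ h d) (δ (h + d) m) ⟩
    τ *ℤ (δ h d +ℤ τ *ℤ δ (h + d) m)    ∎
    where
    δ₁ : δ (m ∸ h) d ≡ δ (h + d) m
    δ₁ = δ-cong (λ e → trans (cong (_+_ h) (sym e)) (ℕ.m+[n∸m]≡n h≤m))
                (λ e → trans (cong (_∸ h) (sym e)) (ℕ.m+n∸m≡n h d))
    δ₂ : δ (m ∸ h + d) m ≡ δ h d
    δ₂ = δ-cong (λ e → sym (ℕ.+-cancelˡ-≡ (m ∸ h) d h (trans e (sym (ℕ.m∸n+n≡m h≤m)))))
                (λ e → trans (cong (_+_ (m ∸ h)) (sym e)) (ℕ.m∸n+n≡m h≤m))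
    factor : ∀ τ x y → τ *ℤ τ *ℤ y +ℤ τ *ℤ x ≡ τ *ℤ (x +ℤ τ *ℤ y)
    factor = solve-∀

  χ-vanishes : ∀ {d y} → y ≢ d → y + d ≢ m → χ d y ≡ 0ℤ
  χ-vanishes y≢d y+d≢m =
    trans (cong₂ (λ u w → u +ℤ τ *ℤ w) (δ-≢ y≢d) (δ-≢ y+d≢m))
          (trans (ℤ.+-identityˡ (τ *ℤ 0ℤ)) (ℤ.*-zeroʳ τ))

  χ-odd-even : ∀ j x → χ (suc (2 * j)) (2 * x) ≡ 0ℤ
  χ-odd-even j x = χ-vanishes (ℕ.even≢odd x j) (ℕ.even≢odd k (x + j) ∘ sym ∘ trans (sym odd-sum))
    where
    odd-sum : 2 * x + suc (2 * j) ≡ suc (2 * (x + j))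
    odd-sum = trans (ℕ.+-suc (2 * x) (2 * j)) (cong suc (sym (ℕ.*-distribˡ-+ 2 x j)))

  φ : ℕ → ℕ → ℕ → ℤ
  φ d x y = -1ℤ ^ x *ℤ χ d y

  φ-suc : ∀ d x y → φ d (suc x) y ≡ - φ d x y
  φ-suc d x y = trans (ℤ.*-assoc -1ℤ (-1ℤ ^ x) (χ d y)) (ℤ.-1*i≡-i (φ d x y))

  φ-odd-zeroʳ : ∀ j x → φ (suc (2 * j)) x 0 ≡ 0ℤ
  φ-odd-zeroʳ j x = trans (cong (-1ℤ ^ x *ℤ_) (χ-odd-even j 0)) (ℤ.*-zeroʳ (-1ℤ ^ x))

  φ-reflectˡ : ∀ d t y → t < m → φ d (m ∸ suc t) y ≡ - φ d t y
  φ-reflectˡ d t y t<m =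
    trans (cong (_*ℤ χ d y) (-1^[m∸[1+t]]≡-[-1^t] (-1^[2*k]≡1 k) t<m))
          (sym (ℤ.neg-distribˡ-* (-1ℤ ^ t) (χ d y)))

  φ-reflectʳ : ∀ d x h → h ≤ m → φ d x (m ∸ h) ≡ τ *ℤ φ d x h
  φ-reflectʳ d x h h≤m =
    trans (cong (-1ℤ ^ x *ℤ_) (χ-reflect d h h≤m)) (swap (-1ℤ ^ x) τ (χ d h))
    where
    swap : ∀ s τ y → s *ℤ (τ *ℤ y) ≡ τ *ℤ (s *ℤ y)
    swap = solve-∀

  module PointMass (j : ℕ) = Eigenfunction m τ (φ (suc (2 * j))) τ-involutive
    (φ-suc (suc (2 * j))) (φ-odd-zeroʳ j) (φ-reflectˡ (suc (2 * j))) (φ-reflectʳ (suc (2 * j)))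

  module _ (r : ℕ) (r≤k : r ≤ k)
           (antipodal : ∀ (i j : Fin r) → suc (toℕ i + toℕ j) ≡ k → i ≡ j × τ ≡ 1ℤ) where

    odd : Fin r → ℕ
    odd i = suc (2 * toℕ i)

    odd-injective : ∀ {i j} → odd i ≡ odd j → i ≡ j
    odd-injective e = toℕ-injective (ℕ.*-cancelˡ-≡ _ _ 2 (ℕ.suc-injective e))

    odd+odd≡m⇒antipodal : ∀ i j → odd i + odd j ≡ m → suc (toℕ i + toℕ j) ≡ k
    odd+odd≡m⇒antipodal i j e = ℕ.*-cancelˡ-≡ _ _ 2 (trans (sym (odd+odd≡2*suc (toℕ i) (toℕ j))) e)

    odd<m : ∀ i → 0 + odd i < m
    odd<m i = subst (_≤ m) (ℕ.*-suc 2 (toℕ i)) (ℕ.*-monoʳ-≤ 2 (ℕ.<-≤-trans (toℕ<n i) r≤k))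

    apex : Fin r → Tri m
    apex i = up 0 (odd i) (odd<m i)

    m∸[1+odd]-even : ∀ i → m ∸ suc (odd i) ≡ 2 * (k ∸ suc (toℕ i))
    m∸[1+odd]-even i = sym (trans (ℕ.*-distribˡ-∸ 2 k (suc (toℕ i))) (cong (m ∸_) (ℕ.*-suc 2 (toℕ i))))

    apex-value : ∀ i j → PointMass.triValue (toℕ j) (apex i) ≡ χ (odd j) (odd i)
    apex-value i j = begin
      PointMass.triValue (toℕ j) (apex i)
        ≡⟨ PointMass.triValue-up₀ (toℕ j) (odd i) (odd<m i) ⟩
      1ℤ *ℤ χ (odd j) (odd i) +ℤ -1ℤ ^ odd i *ℤ χ (odd j) (m ∸ suc (odd i))
        ≡⟨ cong₂ _+ℤ_ (ℤ.*-identityˡ (χ (odd j) (odd i))) (cong (-1ℤ ^ odd i *ℤ_) vanishes) ⟩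
      χ (odd j) (odd i) +ℤ -1ℤ ^ odd i *ℤ 0ℤ
        ≡⟨ cong (χ (odd j) (odd i) +ℤ_) (ℤ.*-zeroʳ (-1ℤ ^ odd i)) ⟩
      χ (odd j) (odd i) +ℤ 0ℤ
        ≡⟨ ℤ.+-identityʳ _ ⟩
      χ (odd j) (odd i) ∎
      where
      vanishes : χ (odd j) (m ∸ suc (odd i)) ≡ 0ℤ
      vanishes = trans (cong (χ (odd j)) (m∸[1+odd]-even i)) (χ-odd-even (toℕ j) (k ∸ suc (toℕ i)))

    χ-off-diagonal : ∀ i j → i ≢ j → χ (odd j) (odd i) ≡ 0ℤ
    χ-off-diagonal i j i≢j =
      χ-vanishes (i≢j ∘ odd-injective) (i≢j ∘ proj₁ ∘ antipodal i j ∘ odd+odd≡m⇒antipodal i j)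

    χ-diagonal : ∀ i → χ (odd i) (odd i) ≢ 0ℤ
    χ-diagonal i = by-cases (odd i + odd i ≟ m)
      where
      by-cases : Dec (odd i + odd i ≡ m) → χ (odd i) (odd i) ≢ 0ℤ
      by-cases (yes e) =
        subst (_≢ 0ℤ) (sym (cong₂ (λ u w → u +ℤ τ *ℤ w) (δ-≡ {odd i} refl) (δ-≡ e)))
              (1+τ≢0 (proj₂ (antipodal i i (odd+odd≡m⇒antipodal i i e))))
        where
        1+τ≢0 : τ ≡ 1ℤ → 1ℤ +ℤ τ *ℤ 1ℤ ≢ 0ℤ
        1+τ≢0 refl ()
      by-cases (no ne) =
        subst (_≢ 0ℤ) (sym (trans (cong₂ (λ u w → u +ℤ τ *ℤ w) (δ-≡ {odd i} refl) (δ-≢ ne))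
                                  (cong (1ℤ +ℤ_) (ℤ.*-zeroʳ τ))))
              (λ ())

    eigenvalueMultAtLeast : ∀ {n} (X : OrientedCubicGraph n) →
                            EigenvalueMultAtLeast (GC.nbr X m) (+ 3 +ℤ τ) r
    eigenvalueMultAtLeast X =
      f , (λ j → PointMass.OnGoldbergCoxeter.eigenfunction-isEigen (toℕ j) X) ,
      diagonal⇒LinIndep f point
        (λ i j i≢j → trans (apex-value i j) (χ-off-diagonal i j i≢j))
        (λ i → subst (_≢ 0ℤ) (sym (apex-value i i)) (χ-diagonal i))
      where
      f : Fin r → GC.Vtx X m → ℤ
      f j = PointMass.OnGoldbergCoxeter.eigenfunction (toℕ j) X
      point : Fin r → GC.Vtx X m
      point i = OrientedCubicGraph.base X , apex i

theorem1p4 : ∀ {n} (X : OrientedCubicGraph n) (k : ℕ) → 1 ≤ k →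
    EigenvalueMultAtLeast (GC.nbr X (2 * k)) (+ 4) ⌈ k /2⌉
      × EigenvalueMultAtLeast (GC.nbr X (2 * k)) (+ 2) ⌊ k /2⌋
theorem1p4 X k _ =
  OddPointMasses.eigenvalueMultAtLeast k 1ℤ refl ⌈ k /2⌉ (ℕ.⌈n/2⌉≤n k) ceil-antipodal X ,
  OddPointMasses.eigenvalueMultAtLeast k -1ℤ refl ⌊ k /2⌋ (ℕ.⌊n/2⌋≤n k) floor-antipodal X
  where
  ceil-antipodal : ∀ i j → suc (toℕ i + toℕ j) ≡ k → i ≡ j × 1ℤ ≡ 1ℤ
  ceil-antipodal i j e = ⌈k/2⌉-antipodal⇒≡ k i j e , refl
  floor-antipodal : ∀ i j → suc (toℕ i + toℕ j) ≡ k → i ≡ j × -1ℤ ≡ 1ℤ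
  floor-antipodal i j e = contradiction e (⌊k/2⌋-antipodal-free k i j)
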